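{- Let $n\ge1$ and let $\mathcal F_n=\mathfrak Z^{\{1,\dots,n\}}$ be the RM-algebra of nonempty faces of the $n$-cube, with the pointwise operations. Let $a,b\in\mathcal F_n$ be compatible, i.e. there is $c\in\mathcal F_n$ with $c\sqcup a=a$ and $c\sqcup b=b$. Then the intersection $a\sqcap b$ of the faces $a$ and $b$ satisfies $$a\sqcap b=\bigl(1/2\wedge\nabla(a\wedge\neg a)\wedge\nabla(b\wedge\neg b)\bigr)\vee\neg\nabla(\neg a\wedge\neg b).$$
   Context: Let $\mathfrak Z=\{0,1/2,1\}$, with $x\wedge y=\min(x,y)$, and with $x\sqcup y=x$ if $x=y$ and $x\sqcup y=1/2$ otherwise. Let $\partial(x,y)=1/2$ if $y=1/2$. If $y\in\{0,1\}$, then $\partial(x,y)=y$ when $x=y$, and $\partial(x,y)=1-y$ when $x\ne y$. Derived operations: $\neg x=\partial(1/2,x)$ (this is $1-x$), $\nabla x=\partial(x,0)$ (this is $\min(1,2x)$), and $x\vee y=\neg(\neg x\wedge\neg y)$ (this is $\max$). All operations on $\mathcal F_n$ are applied pointwise. A function $f\colon\{1,\dots,n\}\to\mathfrak Z$ is identified with the face $\{x\in[0,1]^n: x_i=f(i)\text{ whenever } f(i)\in\{0,1\}\}$. For compatible $a,b$ (equivalently, $\{a(i),b(i)\}\ne\{0,1\}$ for all $i$), the intersection $a\sqcap b$ is the pointwise Rota–Metropolis operation: $x\sqcap 1/2=1/2\sqcap x=x$ and $x\sqcap x=x$. -}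

module Defs where

open import Data.Nat using (ℕ)
open import Data.Fin using (Fin)

-- The three-element set 𝔷 = {0, 1/2, 1}
data Z : Set where
  z0 : Z
  zh : Z
  z1 : Z

_∧_ : Z → Z → Z
z0 ∧ y  = z0
zh ∧ z0 = z0
zh ∧ zh = zh
zh ∧ z1 = zh
z1 ∧ y  = y

_⊔_ : Z → Z → Z
z0 ⊔ z0 = z0
z1 ⊔ z1 = z1
zh ⊔ zh = zh
_  ⊔ _  = zh

∂ : Z → Z → Z
∂ x  zh = zh
∂ z0 z0 = z0
∂ zh z0 = z1
∂ z1 z0 = z1
∂ z1 z1 = z1
∂ z0 z1 = z0
∂ zh z1 = z0

¬z : Z → Z
¬z x = ∂ zh x

∇z : Z → Z
∇z x = ∂ x z0

_∨_ : Z → Z → Z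
x ∨ y = ¬z (¬z x ∧ ¬z y)

-- Rota–Metropolis intersection on compatible values:
-- x ⊓ 1/2 = 1/2 ⊓ x = x, x ⊓ x = x.  (The incompatible pairs {0,1}
-- never arise for compatible faces; the value chosen there is irrelevant.)
_⊓_ : Z → Z → Z
zh ⊓ y  = y
x  ⊓ zh = x
z0 ⊓ z0 = z0
z1 ⊓ z1 = z1
z0 ⊓ z1 = zh
z1 ⊓ z0 = zh

-- 𝓕ₙ : faces of the n-cube, operations pointwise
F : ℕ → Set
F n = Fin n → Z

half : ∀ {n} → F n
half _ = zh

_∧ᶠ_ : ∀ {n} → F n → F n → F n
(a ∧ᶠ b) i = a i ∧ b i

_∨ᶠ_ : ∀ {n} → F n → F n → F n
(a ∨ᶠ b) i = a i ∨ b i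

_⊔ᶠ_ : ∀ {n} → F n → F n → F n
(a ⊔ᶠ b) i = a i ⊔ b i

_⊓ᶠ_ : ∀ {n} → F n → F n → F n
(a ⊓ᶠ b) i = a i ⊓ b i

¬ᶠ : ∀ {n} → F n → F n
¬ᶠ a i = ¬z (a i)

∇ᶠ : ∀ {n} → F n → F n
∇ᶠ a i = ∇z (a i)

infixr 7 _∧ᶠ_
infixr 6 _∨ᶠ_

module Submission where

open import Defs
open import Data.Nat using (ℕ; _≥_)
open import Data.Fin using (Fin)
open import Data.Product using (∃; _×_; _,_)
open import Relation.Binary.PropositionalEquality using (_≡_; refl)

data Compatible : Z → Z → Set where
  half-left  : ∀ {y} → Compatible zh y
  half-right : ∀ {x} → Compatible x zh
  diagonal   : ∀ {x} → Compatible x x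

-- c ⊔ x ≡ x says that the face x lies inside the face c.
common-superface⇒compatible : ∀ {x y} c → c ⊔ x ≡ x → c ⊔ y ≡ y → Compatible x y
common-superface⇒compatible {zh} _  _ _ = half-left
common-superface⇒compatible {y = zh} _ _ _ = half-right
common-superface⇒compatible {z0} {z0} _ _ _ = diagonal
common-superface⇒compatible {z1} {z1} _ _ _ = diagonal
common-superface⇒compatible {z0} {z1} z0 _ ()
common-superface⇒compatible {z0} {z1} zh () _
common-superface⇒compatible {z0} {z1} z1 () _
common-superface⇒compatible {z1} {z0} z0 () _
common-superface⇒compatible {z1} {z0} zh () _
common-superface⇒compatible {z1} {z0} z1 _ ()

⊓-formula : ∀ {x y} → Compatible x y →
  x ⊓ y ≡ (zh ∧ (∇z (x ∧ ¬z x) ∧ ∇z (y ∧ ¬z y))) ∨ ¬z (∇z (¬z x ∧ ¬z y))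
⊓-formula {y = z0} half-left  = refl
⊓-formula {y = zh} half-left  = refl
⊓-formula {y = z1} half-left  = refl
⊓-formula {z0}     half-right = refl
⊓-formula {zh}     half-right = refl
⊓-formula {z1}     half-right = refl
⊓-formula {z0}     diagonal   = refl
⊓-formula {zh}     diagonal   = refl
⊓-formula {z1}     diagonal   = refl

proposition4p2 : (n : ℕ) → n ≥ 1 → (a b : F n) →
    ∃ (λ (c : F n) → (∀ i → (c ⊔ᶠ a) i ≡ a i) × (∀ i → (c ⊔ᶠ b) i ≡ b i)) →
    ∀ (i : Fin n) →
      (a ⊓ᶠ b) i ≡ ((half ∧ᶠ ∇ᶠ (a ∧ᶠ ¬ᶠ a) ∧ᶠ ∇ᶠ (b ∧ᶠ ¬ᶠ b)) ∨ᶠ ¬ᶠ (∇ᶠ (¬ᶠ a ∧ᶠ ¬ᶠ b))) i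
proposition4p2 _ _ a b (c , c⊇a , c⊇b) i =
  ⊓-formula (common-superface⇒compatible (c i) (c⊇a i) (c⊇b i))
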